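{- Let $E\subset\mathbb{N}^2$ be finite and $\sigma\subset\mathbb{N}$ be finite and nonempty, and suppose: (i) for every $(a,b)\in E$ there exist $i,j\in\sigma$ with $a\le i<j<b$; and (ii) no two distinct pairs of $E$ share an endpoint, i.e. if $(a,b)\ne(c,d)$ are in $E$ then $a\ne c$ and $b\ne d$. Then \[ \sum_{(a,b)\in E}(b-a) \ge \frac{2|E|^2}{|\sigma|}. \]
   Context: A pair $(E,\sigma)$ satisfying (i) and (ii) is called a P3-system. The quantity $\|E\|=\sum_{(a,b)\in E}(b-a)$ is called the extent of $E$. -}

module Defs where

open import Data.Nat using (ℕ; _∸_; _≤_; _<_; _*_)
open import Data.Product using (_×_; _,_; proj₁; proj₂; ∃₂)
open import Data.List using (List; []; _∷_; map; length)
open import Data.Nat.ListAction using (sum)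
open import Data.List.Membership.Propositional using (_∈_)
open import Data.List.Relation.Unary.Unique.Propositional using (Unique)
open import Relation.Binary.PropositionalEquality using (_≡_; _≢_)

-- A finite set E ⊂ ℕ² is a duplicate-free list of pairs;
-- a finite set σ ⊂ ℕ is a duplicate-free list of naturals.

CondI : List (ℕ × ℕ) → List ℕ → Set
CondI E σ = ∀ {a b} → (a , b) ∈ E →
  ∃₂ λ i j → i ∈ σ × j ∈ σ × a ≤ i × i < j × j < b

CondII : List (ℕ × ℕ) → Set
CondII E = ∀ {p q} → p ∈ E → q ∈ E → p ≢ q →
  proj₁ p ≢ proj₁ q × proj₂ p ≢ proj₂ q

-- Extent ‖E‖ = Σ_{(a,b)∈E} (b - a)   (b > a by (i), so ∸ is true subtraction)
extent : List (ℕ × ℕ) → ℕ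
extent E = sum (map (λ p → proj₂ p ∸ proj₁ p) E)

{-# OPTIONS --safe #-}
module Submission where

-- For an edge (a , b) let first a be the least point of σ at or above a and second a the next point of σ,
-- so that b − a = (first a − a) + (second a − first a) + (b − second a) with second a < b.
-- Group the edges by p = first a (α p of them) and by p = second a (β p of them).  Left endpoints are
-- distinct, so the edges with first a = p contribute Σ (p − a) ≥ α(α − 1)/2, and there are at most p − q
-- of them for every q ∈ σ below p; hence each edge with second a = p has second a − first a ≥ α p.
-- Right endpoints are distinct, so the edges with second a = p contribute Σ (b − p) ≥ β(β + 1)/2.
-- Together (α p + β p)² + β p ≤ 2 W p + α p, where W p is the part of ‖E‖ charged to p.  Summing over σ,
-- where Σ α = Σ β = |E|, gives Σ (α + β)² ≤ 2‖E‖, and Cauchy–Schwarz turns this into (2|E|)² ≤ 2|σ|‖E‖.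

open import Defs
open import Data.Empty using (⊥-elim)
open import Data.List using (List; []; _∷_; [_]; _++_; map; length; filter)
open import Data.List.Extrema.Nat using (min; max; argmin-sel; min≤v⁺; v≤min⁺; xs≤max)
open import Data.List.Membership.Propositional using (_∈_)
open import Data.List.Membership.Propositional.Properties using (∈-filter⁺; ∈-filter⁻)
open import Data.List.Properties using (length-map; map-++; map-cong-local; filter-accept; filter-reject; filter-++)
open import Data.List.Relation.Unary.All as All using (All; []; _∷_)
open import Data.List.Relation.Unary.All.Properties using (all-filter; ─⁺; map⁺; ¬Any⇒All¬)
open import Data.List.Relation.Unary.Any as Any using (here; there; _─_)
open import Data.List.Relation.Unary.Unique.Propositional using (Unique; []; _∷_)
import Data.List.Relation.Unary.Unique.Propositional.Properties as Unique
open import Data.Nat using (ℕ; zero; suc; _+_; _*_; _∸_; _^_; _≤_; _<_; z≤n; s≤s; _≟_; _≤?_)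
open import Data.Nat.ListAction using (sum)
open import Data.Nat.ListAction.Properties using (sum-++)
open import Data.Nat.Properties
open import Data.Nat.Tactic.RingSolver using (solve-∀)
open import Data.Product using (_×_; _,_; proj₁; proj₂; map₁; curry)
open import Data.Sum using (inj₁; inj₂; [_,_]′)
open import Function using (id; _∘_)
open import Relation.Binary.PropositionalEquality
  using (_≡_; _≢_; refl; sym; trans; cong; cong₂; subst; subst₂; module ≡-Reasoning)
open import Relation.Nullary using (yes; no)

open import Algebra.Properties.CommutativeSemigroup +-commutativeSemigroup using (interchange; x∙yz≈y∙xz)
open import Data.List.Membership.DecPropositional _≟_ using (_∈?_)

private
  variable
    A B : Set

∑ : (A → ℕ) → List A → ℕ
∑ f xs = sum (map f xs)

∑-+ : ∀ (f g : A → ℕ) xs → ∑ (λ x → f x + g x) xs ≡ ∑ f xs + ∑ g xs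
∑-+ f g [] = refl
∑-+ f g (x ∷ xs) = trans (cong (f x + g x +_) (∑-+ f g xs)) (interchange (f x) (g x) (∑ f xs) (∑ g xs))

∑-+₃ : ∀ (f g h : A → ℕ) xs → ∑ (λ x → f x + g x + h x) xs ≡ ∑ f xs + ∑ g xs + ∑ h xs
∑-+₃ f g h xs = trans (∑-+ (λ x → f x + g x) h xs) (cong (_+ ∑ h xs) (∑-+ f g xs))

∑-*ˡ : ∀ c (f : A → ℕ) xs → ∑ (λ x → c * f x) xs ≡ c * ∑ f xs
∑-*ˡ c f [] = sym (*-zeroʳ c)
∑-*ˡ c f (x ∷ xs) = trans (cong (c * f x +_) (∑-*ˡ c f xs)) (sym (*-distribˡ-+ c (f x) (∑ f xs)))

∑-cong : ∀ {f g : A → ℕ} {xs} → All (λ x → f x ≡ g x) xs → ∑ f xs ≡ ∑ g xs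
∑-cong = cong sum ∘ map-cong-local

∑-mono : ∀ {f g : A → ℕ} → (∀ x → f x ≤ g x) → ∀ xs → ∑ f xs ≤ ∑ g xs
∑-mono f≤g [] = z≤n
∑-mono f≤g (x ∷ xs) = +-mono-≤ (f≤g x) (∑-mono f≤g xs)

∑-zero : ∀ {f : A → ℕ} {xs} → All (λ x → f x ≡ 0) xs → ∑ f xs ≡ 0
∑-zero [] = refl
∑-zero (fx≡0 ∷ fxs≡0) = cong₂ _+_ fx≡0 (∑-zero fxs≡0)

∑-++ : ∀ (f : A → ℕ) xs ys → ∑ f (xs ++ ys) ≡ ∑ f xs + ∑ f ys
∑-++ f xs ys = trans (cong sum (map-++ f xs ys)) (sum-++ (map f xs) (map f ys))

length≡∑1 : (xs : List A) → length xs ≡ ∑ (λ _ → 1) xs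
length≡∑1 [] = refl
length≡∑1 (x ∷ xs) = cong suc (length≡∑1 xs)

length*≤∑ : ∀ {c} {f : A → ℕ} {xs} → All (λ x → c ≤ f x) xs → length xs * c ≤ ∑ f xs
length*≤∑ [] = z≤n
length*≤∑ (c≤fx ∷ c≤fxs) = +-mono-≤ c≤fx (length*≤∑ c≤fxs)

2*m*n≤m*m+n*n : ∀ m n → 2 * m * n ≤ m * m + n * n
2*m*n≤m*m+n*n m n =
  [ ordered , (λ n≤m → subst₂ _≤_ (swap n m) (+-comm (n * n) (m * m)) (ordered n≤m)) ]′ (≤-total m n)
  where
  swap : ∀ n m → 2 * n * m ≡ 2 * m * n
  swap = solve-∀
  square-gap : ∀ m d → 2 * m * (m + d) + d * d ≡ m * m + (m + d) * (m + d)
  square-gap = solve-∀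
  ordered : ∀ {m n} → m ≤ n → 2 * m * n ≤ m * m + n * n
  ordered {m} m≤n with d , refl ← m≤n⇒∃[o]m+o≡n m≤n = ≤-trans (m≤m+n _ (d * d)) (≤-reflexive (square-gap m d))

cauchy-schwarz : ∀ (f : A → ℕ) xs → ∑ f xs * ∑ f xs ≤ length xs * ∑ (λ x → f x * f x) xs
cauchy-schwarz f [] = z≤n
cauchy-schwarz f (x ∷ []) = ≤-reflexive (singleton (f x))
  where
  singleton : ∀ a → (a + 0) * (a + 0) ≡ 1 * (a * a + 0)
  singleton = solve-∀
cauchy-schwarz f (x ∷ y ∷ ys) = step (f x) (length ys) (cauchy-schwarz f (y ∷ ys))
  where
  open ≤-Reasoning
  expand : ∀ a S → (a + S) * (a + S) ≡ a * a + 2 * a * S + S * S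
  expand = solve-∀
  scale : ∀ m a S → m * (2 * a * S) ≡ 2 * (m * a) * S
  scale = solve-∀
  collect : ∀ m a Q → m * a * (m * a) + m * Q ≡ m * (m * (a * a) + Q)
  collect = solve-∀
  regroup : ∀ m a Q → a * a + (m * (a * a) + Q) + m * Q ≡ suc m * (a * a + Q)
  regroup = solve-∀
  cross-term : ∀ a n {S Q} → S * S ≤ suc n * Q → 2 * a * S ≤ suc n * (a * a) + Q
  cross-term a n {S} {Q} S²≤ = *-cancelˡ-≤ (suc n) (begin
    suc n * (2 * a * S)                  ≡⟨ scale (suc n) a S ⟩
    2 * (suc n * a) * S                  ≤⟨ 2*m*n≤m*m+n*n (suc n * a) S ⟩
    suc n * a * (suc n * a) + S * S      ≤⟨ +-monoʳ-≤ _ S²≤ ⟩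
    suc n * a * (suc n * a) + suc n * Q  ≡⟨ collect (suc n) a Q ⟩
    suc n * (suc n * (a * a) + Q)        ∎)
  step : ∀ a n {S Q} → S * S ≤ suc n * Q → (a + S) * (a + S) ≤ suc (suc n) * (a * a + Q)
  step a n {S} {Q} S²≤ = begin
    (a + S) * (a + S)                        ≡⟨ expand a S ⟩
    a * a + 2 * a * S + S * S                ≤⟨ +-mono-≤ (+-monoʳ-≤ (a * a) (cross-term a n S²≤)) S²≤ ⟩
    a * a + (suc n * (a * a) + Q) + suc n * Q ≡⟨ regroup (suc n) a Q ⟩
    suc (suc n) * (a * a + Q)                ∎

square-sum-bound : ∀ (α β W : A → ℕ) xs → ∑ α xs ≡ ∑ β xs →
                   (∀ x → (α x + β x) * (α x + β x) + β x ≤ 2 * W x + α x) →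
                   2 * ∑ α xs ^ 2 ≤ length xs * ∑ W xs
square-sum-bound {A} α β W xs ∑α≡∑β bound = *-cancelˡ-≤ 2 (begin
  2 * (2 * m ^ 2)                   ≡⟨ double-square m ⟩
  (m + m) * (m + m)                 ≡⟨ cong₂ _*_ ∑k≡m+m ∑k≡m+m ⟨
  ∑ k xs * ∑ k xs                   ≤⟨ cauchy-schwarz k xs ⟩
  length xs * ∑ (λ x → k x * k x) xs ≤⟨ *-monoʳ-≤ (length xs) ∑k²≤2∑W ⟩
  length xs * (2 * ∑ W xs)          ≡⟨ pull-2 (length xs) (∑ W xs) ⟩
  2 * (length xs * ∑ W xs)          ∎)
  where
  open ≤-Reasoning
  m : ℕ
  m = ∑ α xs
  k : A → ℕ
  k x = α x + β x
  double-square : ∀ n → 2 * (2 * (n * (n * 1))) ≡ (n + n) * (n + n)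
  double-square = solve-∀
  pull-2 : ∀ n w → n * (2 * w) ≡ 2 * (n * w)
  pull-2 = solve-∀
  ∑k≡m+m : ∑ k xs ≡ m + m
  ∑k≡m+m = trans (∑-+ α β xs) (cong (m +_) (sym ∑α≡∑β))
  ∑k²≤2∑W : ∑ (λ x → k x * k x) xs ≤ 2 * ∑ W xs
  ∑k²≤2∑W = +-cancelʳ-≤ m _ _ (begin
    ∑ (λ x → k x * k x) xs + m                 ≡⟨ cong (∑ (λ x → k x * k x) xs +_) ∑α≡∑β ⟩
    ∑ (λ x → k x * k x) xs + ∑ β xs            ≡⟨ ∑-+ (λ x → k x * k x) β xs ⟨
    ∑ (λ x → k x * k x + β x) xs               ≤⟨ ∑-mono bound xs ⟩
    ∑ (λ x → 2 * W x + α x) xs                 ≡⟨ ∑-+ (λ x → 2 * W x) α xs ⟩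
    ∑ (λ x → 2 * W x) xs + m                   ≡⟨ cong (_+ m) (∑-*ˡ 2 W xs) ⟩
    2 * ∑ W xs + m                             ∎)

group-square-bound : ∀ α β X Y Z → α * α ≤ 2 * X + α → β * (2 + β) ≤ 2 * Z + β → β * α ≤ Y →
                     (α + β) * (α + β) + β ≤ 2 * (X + Y + Z) + α
group-square-bound α β X Y Z X-bound Z-bound Y-bound = +-cancelʳ-≤ β _ _ (begin
  (α + β) * (α + β) + β + β                ≡⟨ expand α β ⟩
  α * α + β * (2 + β) + 2 * (β * α)        ≤⟨ +-mono-≤ (+-mono-≤ X-bound Z-bound) (*-monoʳ-≤ 2 Y-bound) ⟩
  (2 * X + α) + (2 * Z + β) + 2 * Y        ≡⟨ collect α β X Y Z ⟩
  2 * (X + Y + Z) + α + β                  ∎)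
  where
  open ≤-Reasoning
  expand : ∀ α β → (α + β) * (α + β) + β + β ≡ α * α + β * (2 + β) + 2 * (β * α)
  expand = solve-∀
  collect : ∀ α β X Y Z → (2 * X + α) + (2 * Z + β) + 2 * Y ≡ 2 * (X + Y + Z) + α + β
  collect = solve-∀

∸-telescope : ∀ {a b c} → a ≤ b → b ≤ c → c ∸ a ≡ (b ∸ a) + (c ∸ b)
∸-telescope {a} {b} {c} a≤b b≤c = begin
  c ∸ a             ≡⟨ cong (_∸ a) (m∸n+n≡m b≤c) ⟨
  (c ∸ b + b) ∸ a   ≡⟨ +-∸-assoc (c ∸ b) a≤b ⟩
  c ∸ b + (b ∸ a)   ≡⟨ +-comm (c ∸ b) (b ∸ a) ⟩
  (b ∸ a) + (c ∸ b) ∎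
  where open ≡-Reasoning

module _ (key : A → ℕ) where

  fiber : ℕ → List A → List A
  fiber p = filter (λ x → key x ≟ p)

  ∑-fiber-∷ : ∀ (g : A → ℕ) p x xs → ∑ g (fiber p (x ∷ xs)) ≡ ∑ g (fiber p [ x ]) + ∑ g (fiber p xs)
  ∑-fiber-∷ g p x xs = trans (cong (∑ g) (filter-++ (λ x → key x ≟ p) [ x ] xs)) (∑-++ g (fiber p [ x ]) (fiber p xs))

  ∑-fibers-singleton : ∀ (g : A → ℕ) x {σ} → Unique σ → key x ∈ σ → ∑ (λ p → ∑ g (fiber p [ x ])) σ ≡ g x
  ∑-fibers-singleton g x (k∉σ ∷ _) (here refl) =
    trans (cong₂ _+_ (cong (∑ g) (filter-accept (λ x → key x ≟ _) refl)) (∑-zero (All.map elsewhere k∉σ)))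
          (trans (+-identityʳ _) (+-identityʳ (g x)))
    where
    elsewhere : ∀ {p} → key x ≢ p → ∑ g (fiber p [ x ]) ≡ 0
    elsewhere k≢p = cong (∑ g) (filter-reject (λ x → key x ≟ _) k≢p)
  ∑-fibers-singleton g x (q∉σ ∷ uσ) (there k∈σ) =
    cong₂ _+_ (cong (∑ g) (filter-reject (λ x → key x ≟ _) (λ k≡q → All.lookup q∉σ k∈σ (sym k≡q))))
              (∑-fibers-singleton g x uσ k∈σ)

  ∑-fibers : ∀ (g : A → ℕ) {σ} → Unique σ → ∀ {xs} → All (λ x → key x ∈ σ) xs →
             ∑ g xs ≡ ∑ (λ p → ∑ g (fiber p xs)) σ
  ∑-fibers g {σ} uσ [] = sym (∑-zero (All.universal (λ _ → refl) σ))
  ∑-fibers g {σ} uσ {x ∷ xs} (k∈σ ∷ ks∈σ) = begin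
    g x + ∑ g xs
      ≡⟨ cong₂ _+_ (sym (∑-fibers-singleton g x uσ k∈σ)) (∑-fibers g uσ ks∈σ) ⟩
    ∑ (λ p → ∑ g (fiber p [ x ])) σ + ∑ (λ p → ∑ g (fiber p xs)) σ
      ≡⟨ ∑-+ (λ p → ∑ g (fiber p [ x ])) (λ p → ∑ g (fiber p xs)) σ ⟨
    ∑ (λ p → ∑ g (fiber p [ x ]) + ∑ g (fiber p xs)) σ
      ≡⟨ ∑-cong (All.universal (λ p → ∑-fiber-∷ g p x xs) σ) ⟨
    ∑ (λ p → ∑ g (fiber p (x ∷ xs))) σ ∎
    where open ≡-Reasoning

  length-fibers : ∀ {σ} → Unique σ → ∀ {xs} → All (λ x → key x ∈ σ) xs →
                  length xs ≡ ∑ (λ p → length (fiber p xs)) σ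
  length-fibers {σ} uσ {xs} ks∈σ = begin
    length xs                                  ≡⟨ length≡∑1 xs ⟩
    ∑ (λ _ → 1) xs                             ≡⟨ ∑-fibers (λ _ → 1) uσ ks∈σ ⟩
    ∑ (λ p → ∑ (λ _ → 1) (fiber p xs)) σ       ≡⟨ ∑-cong (All.universal (λ p → length≡∑1 (fiber p xs)) σ) ⟨
    ∑ (λ p → length (fiber p xs)) σ            ∎
    where open ≡-Reasoning

Unique-map⁺ : ∀ {f : A → B} {xs} → (∀ {x y} → x ∈ xs → y ∈ xs → x ≢ y → f x ≢ f y) →
              Unique xs → Unique (map f xs)
Unique-map⁺ {xs = []} _ [] = []
Unique-map⁺ {xs = x ∷ xs} f-inj (x∉xs ∷ u) =
  map⁺ (All.tabulate (λ y∈xs → f-inj (here refl) (there y∈xs) (All.lookup x∉xs y∈xs)))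
  ∷ Unique-map⁺ (λ x∈xs y∈xs → f-inj (there x∈xs) (there y∈xs)) u

length-─ : ∀ {x : A} {xs} (x∈xs : x ∈ xs) → length xs ≡ suc (length (xs ─ x∈xs))
length-─ (here refl) = refl
length-─ (there x∈xs) = cong suc (length-─ x∈xs)

sum-─ : ∀ {x xs} (x∈xs : x ∈ xs) → sum xs ≡ x + sum (xs ─ x∈xs)
sum-─ (here refl) = refl
sum-─ {x} {y ∷ xs} (there x∈xs) = trans (cong (y +_) (sum-─ x∈xs)) (x∙yz≈y∙xz y x _)

Unique-─ : ∀ {x : A} {xs} (x∈xs : x ∈ xs) → Unique xs → Unique (x ∷ (xs ─ x∈xs))
Unique-─ (here refl) u = u
Unique-─ {x = x} {xs = y ∷ _} (there x∈xs) (y∉xs ∷ u) with x∉rest ∷ u-rest ← Unique-─ x∈xs u =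
  (x≢y ∷ x∉rest) ∷ ─⁺ x∈xs y∉xs ∷ u-rest
  where
  x≢y : x ≢ y
  x≢y x≡y = All.lookup y∉xs x∈xs (sym x≡y)

All-<-pred : ∀ {t xs} → All (_< suc t) xs → All (t ≢_) xs → All (_< t) xs
All-<-pred = curry (All.zipWith (λ (x≤t , t≢x) → ≤∧≢⇒< (≤-pred x≤t) (t≢x ∘ sym)))

-- The second component is Σ xs ≥ n c + n(n − 1)/2 for n = length xs, doubled to avoid division
-- and subtraction.
unique-bounds : ∀ c k {xs} → Unique xs → All (c ≤_) xs → All (_< k + c) xs →
                length xs ≤ k × length xs * (2 * c + length xs) ≤ 2 * sum xs + length xs
unique-bounds c zero {[]} _ _ _ = z≤n , z≤n
unique-bounds c zero {x ∷ _} _ (c≤x ∷ _) (x<c ∷ _) = ⊥-elim (<⇒≱ x<c c≤x)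
unique-bounds c (suc k) {xs} u c≤xs xs<t+1 with k + c ∈? xs
... | no t∉xs = map₁ m≤n⇒m≤1+n (unique-bounds c k u c≤xs (All-<-pred xs<t+1 (¬Any⇒All¬ xs t∉xs)))
... | yes t∈xs
  with t∉rest ∷ u-rest ← Unique-─ t∈xs u
  with r≤k , bound ← unique-bounds c k u-rest (─⁺ t∈xs c≤xs) (All-<-pred (─⁺ t∈xs xs<t+1) t∉rest)
  rewrite length-─ t∈xs | sum-─ t∈xs
  = s≤s r≤k , step (length (xs ─ t∈xs)) (sum (xs ─ t∈xs)) r≤k bound
  where
  open ≤-Reasoning
  split : ∀ c r → suc r * (2 * c + suc r) ≡ r * (2 * c + r) + (2 * c + 2 * r + 1)
  split = solve-∀
  merge : ∀ c k r S → 2 * S + r + (2 * c + 2 * k + 1) ≡ 2 * (k + c + S) + suc r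
  merge = solve-∀
  step : ∀ r S → r ≤ k → r * (2 * c + r) ≤ 2 * S + r → suc r * (2 * c + suc r) ≤ 2 * (k + c + S) + suc r
  step r S r≤k bound = begin
    suc r * (2 * c + suc r)               ≡⟨ split c r ⟩
    r * (2 * c + r) + (2 * c + 2 * r + 1) ≤⟨ +-mono-≤ bound (+-monoˡ-≤ 1 (+-monoʳ-≤ (2 * c) (*-monoʳ-≤ 2 r≤k))) ⟩
    2 * S + r + (2 * c + 2 * k + 1)       ≡⟨ merge c k r S ⟩
    2 * (k + c + S) + suc r               ∎

unique-<⇒length≤ : ∀ {k xs} → Unique xs → All (_< k) xs → length xs ≤ k
unique-<⇒length≤ {k} u xs<k =
  proj₁ (unique-bounds 0 k u (All.universal (λ _ → z≤n) _) (All.map (subst (_ <_) (sym (+-identityʳ k))) xs<k))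

unique-≥⇒sum≥ : ∀ {c xs} → Unique xs → All (c ≤_) xs →
                length xs * (2 * c + length xs) ≤ 2 * sum xs + length xs
unique-≥⇒sum≥ {c} {xs} u c≤xs =
  proj₂ (unique-bounds c (suc (max 0 xs)) u c≤xs (All.map (λ x≤max → s≤s (≤-trans x≤max (m≤m+n _ c))) (xs≤max 0 xs)))

module _ (σ : List ℕ) where

  -- max 0 σ is a junk default, returned only when no point of σ is ≥ a.
  ceil : ℕ → ℕ
  ceil a = min (max 0 σ) (filter (a ≤?_) σ)

  ceil-minimal : ∀ {a z} → z ∈ σ → a ≤ z → ceil a ≤ z
  ceil-minimal {a} z∈σ a≤z =
    min≤v⁺ (max 0 σ) _ (inj₂ (Any.map (≤-reflexive ∘ sym) (∈-filter⁺ (a ≤?_) z∈σ a≤z)))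

  ≤-ceil : ∀ {a y} → y ∈ σ → a ≤ y → a ≤ ceil a
  ≤-ceil {a} y∈σ a≤y = v≤min⁺ (≤-trans a≤y (All.lookup (xs≤max 0 σ) y∈σ)) (all-filter (a ≤?_) σ)

  ∈∧<ceil⇒< : ∀ {a q} → q ∈ σ → q < ceil a → q < a
  ∈∧<ceil⇒< q∈σ q<ceil = ≰⇒> (λ a≤q → <⇒≱ q<ceil (ceil-minimal q∈σ a≤q))

  ceil-∈ : ∀ {a y} → y ∈ σ → a ≤ y → ceil a ∈ σ
  ceil-∈ {a} {y} y∈σ a≤y with argmin-sel id (max 0 σ) (filter (a ≤?_) σ)
  ... | inj₂ ceil∈ = proj₁ (∈-filter⁻ (a ≤?_) ceil∈)
  ... | inj₁ ceil≡max = subst (_∈ σ) (≤-antisym y≤ceil (ceil-minimal y∈σ a≤y)) y∈σ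
    where
    y≤ceil : y ≤ ceil a
    y≤ceil = subst (y ≤_) (sym ceil≡max) (All.lookup (xs≤max 0 σ) y∈σ)

module P3System {E : List (ℕ × ℕ)} {σ : List ℕ}
                (uE : Unique E) (uσ : Unique σ) (condI : CondI E σ) (condII : CondII E) where

  first second : ℕ → ℕ
  first a = ceil σ a
  second a = ceil σ (suc (first a))

  record Chain (a b : ℕ) : Set where
    field
      first∈σ : first a ∈ σ
      second∈σ : second a ∈ σ
      a≤first : a ≤ first a
      first<second : first a < second a
      second<b : second a < b

  chain : ∀ {e} → e ∈ E → Chain (proj₁ e) (proj₂ e)
  chain {a , _} e∈E with i , j , i∈σ , j∈σ , a≤i , i<j , j<b ← condI e∈E = record
    { first∈σ = ceil-∈ σ i∈σ a≤i
    ; second∈σ = ceil-∈ σ j∈σ first<j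
    ; a≤first = ≤-ceil σ i∈σ a≤i
    ; first<second = ≤-ceil σ j∈σ first<j
    ; second<b = ≤-<-trans (ceil-minimal σ j∈σ first<j) j<b
    }
    where
    first<j : first a < j
    first<j = ≤-<-trans (ceil-minimal σ i∈σ a≤i) i<j

  open Chain

  left middle right : ℕ × ℕ → ℕ
  left (a , _) = first a ∸ a
  middle (a , _) = second a ∸ first a
  right (a , b) = b ∸ second a

  edge-split : ∀ {e} → e ∈ E → proj₂ e ∸ proj₁ e ≡ left e + middle e + right e
  edge-split {a , b} e∈E = begin
    b ∸ a                                                  ≡⟨ ∸-telescope (a≤first c) (<⇒≤ first<b) ⟩
    (first a ∸ a) + (b ∸ first a)                          ≡⟨ cong (first a ∸ a +_) (∸-telescope (<⇒≤ (first<second c)) (<⇒≤ (second<b c))) ⟩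
    (first a ∸ a) + ((second a ∸ first a) + (b ∸ second a)) ≡⟨ +-assoc (first a ∸ a) _ _ ⟨
    (first a ∸ a) + (second a ∸ first a) + (b ∸ second a)  ∎
    where
    open ≡-Reasoning
    c : Chain a b
    c = chain e∈E
    first<b : first a < b
    first<b = <-trans (first<second c) (second<b c)

  firstAt secondAt : ℕ → List (ℕ × ℕ)
  firstAt p = fiber (first ∘ proj₁) p E
  secondAt p = fiber (second ∘ proj₁) p E

  ∈-firstAt⁻ : ∀ {p e} → e ∈ firstAt p → e ∈ E × first (proj₁ e) ≡ p
  ∈-firstAt⁻ = ∈-filter⁻ _

  ∈-secondAt⁻ : ∀ {p e} → e ∈ secondAt p → e ∈ E × second (proj₁ e) ≡ p
  ∈-secondAt⁻ = ∈-filter⁻ _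

  α β X Y Z W : ℕ → ℕ
  α p = length (firstAt p)
  β p = length (secondAt p)
  X p = ∑ left (firstAt p)
  Y p = ∑ middle (secondAt p)
  Z p = ∑ right (secondAt p)
  W p = X p + Y p + Z p

  left-injective : ∀ {p e e′} → e ∈ firstAt p → e′ ∈ firstAt p → e ≢ e′ → left e ≢ left e′
  left-injective {e = a , _} {e′ = a′ , _} e∈ e′∈ e≢e′ left≡
    with e∈E , refl ← ∈-firstAt⁻ e∈
    with e′∈E , first′≡first ← ∈-firstAt⁻ e′∈ =
    proj₁ (condII e∈E e′∈E e≢e′)
      (∸-cancelˡ-≡ (a≤first (chain e∈E)) (subst (a′ ≤_) first′≡first (a≤first (chain e′∈E)))
                   (trans left≡ (cong (_∸ a′) first′≡first)))

  left-unique : ∀ p → Unique (map left (firstAt p))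
  left-unique p = Unique-map⁺ left-injective (Unique.filter⁺ _ uE)

  left<gap : ∀ {p q e} → q ∈ σ → q < p → e ∈ firstAt p → left e < p ∸ q
  left<gap q∈σ q<p e∈ with e∈E , refl ← ∈-firstAt⁻ e∈ =
    ∸-monoʳ-< (∈∧<ceil⇒< σ q∈σ q<p) (a≤first (chain e∈E))

  α≤gap : ∀ {p q} → q ∈ σ → q < p → α p ≤ p ∸ q
  α≤gap {p} q∈σ q<p = subst (_≤ _) (length-map left (firstAt p))
    (unique-<⇒length≤ (left-unique p) (map⁺ (All.tabulate (left<gap q∈σ q<p))))

  X-bound : ∀ p → α p * α p ≤ 2 * X p + α p
  X-bound p = subst (λ n → n * n ≤ 2 * X p + n) (length-map left (firstAt p))
    (unique-≥⇒sum≥ (left-unique p) (All.universal (λ _ → z≤n) _))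

  α≤middle : ∀ {p e} → e ∈ secondAt p → α p ≤ middle e
  α≤middle e∈ with e∈E , refl ← ∈-secondAt⁻ e∈ = α≤gap (first∈σ (chain e∈E)) (first<second (chain e∈E))

  Y-bound : ∀ p → β p * α p ≤ Y p
  Y-bound p = length*≤∑ (All.tabulate α≤middle)

  right-injective : ∀ {p e e′} → e ∈ secondAt p → e′ ∈ secondAt p → e ≢ e′ → right e ≢ right e′
  right-injective {e = _ , b} {e′ = _ , b′} e∈ e′∈ e≢e′ right≡
    with e∈E , refl ← ∈-secondAt⁻ e∈
    with e′∈E , second′≡second ← ∈-secondAt⁻ e′∈ =
    proj₂ (condII e∈E e′∈E e≢e′)
      (∸-cancelʳ-≡ (<⇒≤ (second<b (chain e∈E))) (subst (_≤ b′) second′≡second (<⇒≤ (second<b (chain e′∈E))))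
                   (trans right≡ (cong (b′ ∸_) second′≡second)))

  right-unique : ∀ p → Unique (map right (secondAt p))
  right-unique p = Unique-map⁺ right-injective (Unique.filter⁺ _ uE)

  1≤right : ∀ {p e} → e ∈ secondAt p → 1 ≤ right e
  1≤right e∈ = m<n⇒0<n∸m (second<b (chain (proj₁ (∈-secondAt⁻ e∈))))

  Z-bound : ∀ p → β p * (2 + β p) ≤ 2 * Z p + β p
  Z-bound p = subst (λ n → n * (2 + n) ≤ 2 * Z p + n) (length-map right (secondAt p))
    (unique-≥⇒sum≥ (right-unique p) (map⁺ (All.tabulate 1≤right)))

  group-bound : ∀ p → (α p + β p) * (α p + β p) + β p ≤ 2 * W p + α p
  group-bound p = group-square-bound (α p) (β p) (X p) (Y p) (Z p) (X-bound p) (Z-bound p) (Y-bound p)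

  firsts∈σ : All (λ e → first (proj₁ e) ∈ σ) E
  firsts∈σ = All.tabulate (first∈σ ∘ chain)

  seconds∈σ : All (λ e → second (proj₁ e) ∈ σ) E
  seconds∈σ = All.tabulate (second∈σ ∘ chain)

  length≡∑α : length E ≡ ∑ α σ
  length≡∑α = length-fibers (first ∘ proj₁) uσ firsts∈σ

  length≡∑β : length E ≡ ∑ β σ
  length≡∑β = length-fibers (second ∘ proj₁) uσ seconds∈σ

  extent≡∑W : extent E ≡ ∑ W σ
  extent≡∑W = begin
    extent E                                   ≡⟨ ∑-cong (All.tabulate edge-split) ⟩
    ∑ (λ e → left e + middle e + right e) E    ≡⟨ ∑-+₃ left middle right E ⟩
    ∑ left E + ∑ middle E + ∑ right E          ≡⟨ cong₂ _+_ (cong₂ _+_ (∑-fibers (first ∘ proj₁) left uσ firsts∈σ)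
                                                                      (∑-fibers (second ∘ proj₁) middle uσ seconds∈σ))
                                                            (∑-fibers (second ∘ proj₁) right uσ seconds∈σ) ⟩
    ∑ X σ + ∑ Y σ + ∑ Z σ                      ≡⟨ ∑-+₃ X Y Z σ ⟨
    ∑ W σ                                      ∎
    where open ≡-Reasoning

proposition5 : (E : List (ℕ × ℕ)) → (σ : List ℕ) →
    Unique E → Unique σ → σ ≢ [] →
    CondI E σ → CondII E →
    2 * length E ^ 2 ≤ length σ * extent E
proposition5 E σ uE uσ _ condI condII = begin
  2 * length E ^ 2       ≡⟨ cong (λ m → 2 * m ^ 2) length≡∑α ⟩
  2 * ∑ α σ ^ 2          ≤⟨ square-sum-bound α β W σ (trans (sym length≡∑α) length≡∑β) group-bound ⟩
  length σ * ∑ W σ       ≡⟨ cong (length σ *_) extent≡∑W ⟨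
  length σ * extent E    ∎
  where
  open ≤-Reasoning
  open P3System uE uσ condI condII
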